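{- Let $N$ be a positive integer and $r\geq 2$. Then $$\{vE^{(2)}_{N,r}\cdots E^{(r-1)}_{N,r}: v\in\mathsf{Vect}_{N,r}\}\cap\{w\in\mathsf{Vect}_{N,r}: wE_{N,r}=0\}\;\cong\;\ker\phi^{(r)}\cap\operatorname{Im}\big(\phi^{(r-1)}\circ\cdots\circ\phi^{(2)}\big),$$ i.e. (identifying row and column vectors) $\operatorname{Im}{}^t(E^{(2)}_{N,r}\cdots E^{(r-1)}_{N,r})\cap\ker{}^tE_{N,r}$ is isomorphic to $\ker\phi^{(r)}\cap\operatorname{Im}(\phi^{(r-1)}\circ\cdots\circ\phi^{(2)})$ (for $r=2$ the product of the $E^{(j)}$ and the composite of the $\phi^{(j)}$ are empty, i.e. the identity).
   Context: All vector spaces over $\mathbb Q$. $S_{N,r}=\{(n_1,\dots,n_r)\in\mathbb Z^r: \sum n_i=N,\ n_i\geq 3\text{ odd}\}$, lexicographically decreasingly ordered. $\mathsf{Vect}_{N,r}=\mathbb Q^{S_{N,r}}$ (row vectors); $\mathbf V_{N,r}$ is the span of $x_1^{n_1-1}\cdots x_r^{n_r-1}$, $(n_i)\in S_{N,r}$. The restricted totally even part of a polynomial is the sum of its monomials in which every exponent is even and at least $2$. For $1\le j\le r$, $\phi^{(j)}:\mathbf V_{N,r}\to\mathbf V_{N,r}$ maps $Q$ to the restricted totally even part of $Q(x_1,\dots,x_r)+\sum_{i=r-j+1}^{r-1}\big(Q(x_1,\dots,x_{r-j},x_{i+1}-x_i,x_{r-j+1},\dots,\widehat{x_{i+1}},\dots,x_r)-Q(x_1,\dots,x_{r-j},x_{i+1}-x_i,x_{r-j+1},\dots,\widehat{x_i},\dots,x_r)\big)$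 (hats denote omission). For $f$ in one variable and $g$ in $r-1$ variables, $(f\circ g)(x_1,\dots,x_r)=f(x_1)g(x_2,\dots,x_r)+\sum_{i=1}^{r-1}\big(f(x_{i+1}-x_i)g(x_1,\dots,\widehat{x_{i+1}},\dots,x_r)-(-1)^{\deg f}f(x_i-x_{i+1})g(x_1,\dots,\widehat{x_i},\dots,x_r)\big)$; $e\binom{m_1,\dots,m_r}{n_1,\dots,n_r}$ is the coefficient of $x_1^{n_1-1}\cdots x_r^{n_r-1}$ in $x_1^{m_1-1}\circ(x_1^{m_2-1}\cdots x_{r-1}^{m_r-1})$. $E_{N,r}$ has $(m,n)$ entry $e\binom{m_1,\dots,m_r}{n_1,\dots,n_r}$; for $2\le j\le r$, $E^{(j)}_{N,r}$ has $(m,n)$ entry $\delta_{(m_1,\dots,m_{r-j}),(n_1,\dots,n_{r-j})}\,e\binom{m_{r-j+1},\dots,m_r}{n_{r-j+1},\dots,n_r}$ (Kronecker delta). ${}^tA$ denotes the transpose. -}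

module Defs where

open import Data.Bool using (Bool; true; false; if_then_else_; _∧_)
open import Data.Nat as ℕ using (ℕ; zero; suc; _∸_; _≡ᵇ_; _%_; _≤_)
open import Data.List as L using (List; []; _∷_; _++_; map; concatMap; filter; foldr; foldl; upTo; downFrom; length; take; drop; replicate; zipWith; lookup)
open import Data.List.Properties using (≡-dec)
open import Data.Fin using (Fin)
open import Data.Product using (_×_; _,_; Σ; ∃)
open import Data.Rational using (ℚ; 0ℚ; 1ℚ; _+_; _*_; -_; _-_)
open import Relation.Nullary.Decidable using (⌊_⌋)
open import Relation.Binary.PropositionalEquality using (_≡_)

-- Commutative polynomials over ℚ as formal sums of terms
-- (coefficient, exponent list); all exponent lists in a given polynomial
-- in r variables have length r.

Poly : Set
Poly = List (ℚ × List ℕ)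

unitExp : ℕ → ℕ → List ℕ        -- length r, 1 at (0-based) index k
unitExp zero    _       = []
unitExp (suc r) zero    = 1 ∷ replicate r 0
unitExp (suc r) (suc k) = 0 ∷ unitExp r k

-- the variable x_{k+1} in r variables
var : ℕ → ℕ → Poly
var r k = (1ℚ , unitExp r k) ∷ []

constP : ℕ → ℚ → Poly
constP r c = (c , replicate r 0) ∷ []

scaleP : ℚ → Poly → Poly
scaleP c = map (λ { (d , e) → (c * d , e) })

negP : Poly → Poly
negP = scaleP (- 1ℚ)

_+P_ : Poly → Poly → Poly
p +P q = p ++ q

_-P_ : Poly → Poly → Poly
p -P q = p ++ negP q

mulP : Poly → Poly → Poly
mulP p q = concatMap (λ { (c , e) → map (λ { (d , f) → (c * d , zipWith ℕ._+_ e f) }) q }) p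

powP : ℕ → Poly → ℕ → Poly
powP r p zero    = constP r 1ℚ
powP r p (suc a) = mulP p (powP r p a)

sumP : ℕ → List Poly → Poly
sumP r = foldr _+P_ []

evalMon : ℕ → List ℕ → List Poly → Poly
evalMon r []       _        = constP r 1ℚ
evalMon r (a ∷ as) []       = []
evalMon r (a ∷ as) (p ∷ ps) = mulP (powP r p a) (evalMon r as ps)

substP : ℕ → Poly → List Poly → Poly
substP r P args = concatMap (λ { (c , e) → scaleP c (evalMon r e args) }) P

coeff : Poly → List ℕ → ℚ
coeff P e = foldr (λ { (c , f) acc → if ⌊ ≡-dec ℕ._≟_ f e ⌋ then c + acc else acc }) 0ℚ P

evenGe2 : ℕ → Bool
evenGe2 a = (a % 2 ≡ᵇ 0) ∧ (2 ℕ.≤ᵇ a)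

allB : (ℕ → Bool) → List ℕ → Bool
allB p = foldr (λ a b → p a ∧ b) true

rtePart : Poly → Poly
rtePart = filter (λ { (c , e) → allB evenGe2 e ≟b true })
  where
  open import Data.Bool.Properties using () renaming (_≟_ to _≟b_)

removeIdx : {A : Set} → ℕ → List A → List A
removeIdx _       []       = []
removeIdx zero    (x ∷ xs) = xs
removeIdx (suc k) (x ∷ xs) = x ∷ removeIdx k xs

oneTo : ℕ → List ℕ
oneTo n = map suc (upTo n)

-- The index set S_{N,r}, lexicographically decreasing

oddGe3 : ℕ → Bool
oddGe3 k = (k % 2 ≡ᵇ 1) ∧ (3 ℕ.≤ᵇ k)

S : ℕ → ℕ → List (List ℕ)
S N zero    = if N ≡ᵇ 0 then [] ∷ [] else []
S N (suc r) = concatMap (λ k → map (k ∷_) (S (N ∸ k) r))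
                        (filter (λ k → oddGe3 k ≟b true) (downFrom (suc N)))
  where
  open import Data.Bool.Properties using () renaming (_≟_ to _≟b_)

dim : ℕ → ℕ → ℕ
dim N r = length (S N r)

tup : (N r : ℕ) → Fin (dim N r) → List ℕ
tup N r i = lookup (S N r) i

-- Vect_{N,r} = ℚ^{S_{N,r}}, and also coordinates of V_{N,r} w.r.t. the
-- basis x_1^{n_1-1}⋯x_r^{n_r-1}, (n_i) ∈ S_{N,r}
Vec' : ℕ → Set
Vec' d = Fin d → ℚ

Mat : ℕ → Set
Mat d = Fin d → Fin d → ℚ

sumFin : {d : ℕ} → (Fin d → ℚ) → ℚ
sumFin {zero}  f = 0ℚ
sumFin {suc d} f = f Fin.zero + sumFin (λ i → f (Fin.suc i))
  where import Data.Fin as Fin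

idMat : {d : ℕ} → Mat d
idMat i j = if ⌊ i Data.Fin.≟ j ⌋ then 1ℚ else 0ℚ
  where import Data.Fin

_·M_ : {d : ℕ} → Mat d → Mat d → Mat d
(A ·M B) i k = sumFin (λ j → A i j * B j k)

_·v_ : {d : ℕ} → Vec' d → Mat d → Vec' d
(v ·v A) k = sumFin (λ j → v j * A j k)

-- The operation f ∘ g for f = x_1^a and g = x_1^{b_1}⋯x_{r-1}^{b_{r-1}}
-- (result in r = 1 + length b variables)

negOnePow : ℕ → ℚ
negOnePow zero    = 1ℚ
negOnePow (suc a) = - negOnePow a

circMon : ℕ → List ℕ → Poly
circMon a b =
  evalMon r (a ∷ b) vars
  +P sumP r (map (λ t →
        evalMon r (a ∷ b) ((var r (suc t) -P var r t) ∷ removeIdx (suc t) vars)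
        -P scaleP (negOnePow a)
             (evalMon r (a ∷ b) ((var r t -P var r (suc t)) ∷ removeIdx t vars)))
      (upTo (length b)))
  where
  r = suc (length b)
  vars = map (var r) (upTo r)

eCoef : List ℕ → List ℕ → ℚ
eCoef []       n = 0ℚ
eCoef (m ∷ ms) n = coeff (circMon (m ∸ 1) (map (_∸ 1) ms)) (map (_∸ 1) n)

E : (N r : ℕ) → Mat (dim N r)
E N r i k = eCoef (tup N r i) (tup N r k)

Ej : (N r j : ℕ) → Mat (dim N r)
Ej N r j i k =
  if ⌊ ≡-dec ℕ._≟_ (take (r ∸ j) m) (take (r ∸ j) n) ⌋
  then eCoef (drop (r ∸ j) m) (drop (r ∸ j) n)
  else 0ℚ
  where
  m = tup N r i
  n = tup N r k

twoTo : ℕ → List ℕ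
twoTo r = map (λ t → suc (suc t)) (upTo (r ∸ 2))

Eprod : (N r : ℕ) → Mat (dim N r)
Eprod N r = foldl (λ A j → A ·M Ej N r j) idMat (twoTo r)

toPoly : (N r : ℕ) → Vec' (dim N r) → Poly
toPoly N r Q = L.map (λ { (c , n) → (c , map (_∸ 1) n) })
                     (zipWith _,_ (L.tabulate Q) (S N r))

phiPoly : ℕ → ℕ → Poly → Poly
phiPoly r j P =
  P +P sumP r (map (λ t →
         substP r P (prefix ++ (D t ∷ removeIdx t suffix))
      -P substP r P (prefix ++ (D t ∷ removeIdx (t ∸ 1) suffix)))
    (oneTo (j ∸ 1)))
  where
  vars   = map (var r) (upTo r)
  prefix = take (r ∸ j) vars
  suffix = drop (r ∸ j) vars
  -- x_{i+1} - x_i with i = r - j + t (1-based)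
  D : ℕ → Poly
  D t = var r ((r ∸ j) ℕ.+ t) -P var r ((r ∸ j) ℕ.+ t ∸ 1)

phi : (N r j : ℕ) → Vec' (dim N r) → Vec' (dim N r)
phi N r j Q n = coeff (rtePart (phiPoly r j (toPoly N r Q))) (map (_∸ 1) (tup N r n))

phiComp : (N r : ℕ) → Vec' (dim N r) → Vec' (dim N r)
phiComp N r = foldl (λ F j → λ Q → phi N r j (F Q)) (λ Q → Q) (twoTo r)

_≈v_ : {d : ℕ} → Vec' d → Vec' d → Set
u ≈v w = ∀ i → u i ≡ w i

_+v_ : {d : ℕ} → Vec' d → Vec' d → Vec' d
(u +v w) i = u i + w i

_*v_ : {d : ℕ} → ℚ → Vec' d → Vec' d
(c *v u) i = c * u i

record LinIso {d : ℕ} (U W : Vec' d → Set) : Set where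
  field
    to       : Vec' d → Vec' d
    from     : Vec' d → Vec' d
    to-cong  : ∀ u u' → u ≈v u' → to u ≈v to u'
    from-cong : ∀ w w' → w ≈v w' → from w ≈v from w'
    to-mem   : ∀ u → U u → W (to u)
    from-mem : ∀ w → W w → U (from w)
    to-add   : ∀ u u' → U u → U u' → to (u +v u') ≈v (to u +v to u')
    to-scale : ∀ c u → U u → to (c *v u) ≈v (c *v to u)
    from-to  : ∀ u → U u → from (to u) ≈v u
    to-from  : ∀ w → W w → to (from w) ≈v w

_≅_ : {d : ℕ} → (Vec' d → Set) → (Vec' d → Set) → Set
U ≅ W = LinIso U W

zeroV : {d : ℕ} → Vec' d
zeroV _ = 0ℚ

LHS : (N r : ℕ) → Vec' (dim N r) → Set
LHS N r w = (∃ λ v → w ≈v (v ·v Eprod N r)) × ((w ·v E N r) ≈v zeroV)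

RHS : (N r : ℕ) → Vec' (dim N r) → Set
RHS N r Q = (phi N r r Q ≈v zeroV) × (∃ λ P → Q ≈v phiComp N r P)

module Submission where

-- Identify Q ∈ Vect_{N,r} with the polynomial Σ_n Q_n x^{n-1} of
-- V_{N,r}.  In these coordinates φ^{(j)} is right multiplication by the
-- matrix E^{(j)}_{N,r} (phi-is-matrix), and E^{(r)}_{N,r} = E_{N,r}.  Hence
-- Im(φ^{(r-1)}∘⋯∘φ^{(2)}) = {v E^{(2)}⋯E^{(r-1)}} and ker φ^{(r)} = {w : wE = 0}:
-- both sides of the corollary are the same subspace, and the identity map
-- is the required linear isomorphism.

open import Defs
open import Data.Bool using (Bool; true; false; if_then_else_; _∧_)
open import Data.Bool.Properties using () renaming (_≟_ to _≟b_)
open import Data.Nat as ℕ using (ℕ; zero; suc; _∸_; _≤_; _≤?_)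
import Data.Nat.Properties as ℕP
import Data.Nat.DivMod as DM
open import Data.List as L using (List; []; _∷_; _++_; map; concatMap; filter; length; zipWith; replicate; upTo; take; drop)
import Data.List.Properties as LP
open import Data.List.Properties using (≡-dec)
open import Data.List.Relation.Unary.All using (All; []; _∷_)
import Data.List.Relation.Unary.All as All
import Data.List.Relation.Unary.All.Properties as AllP
open import Data.List.Membership.Propositional.Properties using (∈-lookup)
open import Data.Product using (_×_; _,_; proj₁; proj₂)
open import Data.Maybe using (Maybe; just; nothing; maybe)
import Data.Maybe as Maybe
open import Data.Empty using (⊥-elim)
open import Data.Fin using (Fin)
import Data.Fin as F
open import Data.Rational using (ℚ; 0ℚ; 1ℚ; _+_; _*_; -_)
import Data.Rational.Properties as ℚP
open import Data.Rational.Solver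
open +-*-Solver using (solve; _:+_; _:*_; :-_; _:=_; con)
open import Relation.Nullary using (Dec; yes; no; ¬_)
open import Relation.Nullary.Decidable using (⌊_⌋; dec-true; dec-false; isYes≗does)
open import Relation.Binary.PropositionalEquality
open import Function using (_∘_)

ΣL : {A : Set} → List A → (A → ℚ) → ℚ
ΣL []       h = 0ℚ
ΣL (x ∷ xs) h = h x + ΣL xs h

module _ {A : Set} where

  ΣL-cong : (xs : List A) {h k : A → ℚ} → (∀ x → h x ≡ k x) → ΣL xs h ≡ ΣL xs k
  ΣL-cong []       eq = refl
  ΣL-cong (x ∷ xs) eq = cong₂ _+_ (eq x) (ΣL-cong xs eq)

  ΣL-congAll : {xs : List A} {h k : A → ℚ} → All (λ x → h x ≡ k x) xs → ΣL xs h ≡ ΣL xs k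
  ΣL-congAll []         = refl
  ΣL-congAll (px ∷ pxs) = cong₂ _+_ px (ΣL-congAll pxs)

  ΣL-++ : (xs ys : List A) (h : A → ℚ) → ΣL (xs ++ ys) h ≡ ΣL xs h + ΣL ys h
  ΣL-++ []       ys h = sym (ℚP.+-identityˡ _)
  ΣL-++ (x ∷ xs) ys h = trans (cong (h x +_) (ΣL-++ xs ys h)) (sym (ℚP.+-assoc (h x) _ _))

  ΣL-+ : (xs : List A) (h k : A → ℚ) → ΣL xs (λ x → h x + k x) ≡ ΣL xs h + ΣL xs k
  ΣL-+ []       h k = refl
  ΣL-+ (x ∷ xs) h k rewrite ΣL-+ xs h k =
    solve 4 (λ a b c d → (a :+ b) :+ (c :+ d) := (a :+ c) :+ (b :+ d)) refl (h x) (k x) (ΣL xs h) (ΣL xs k)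

  ΣL-* : (xs : List A) (c : ℚ) (h : A → ℚ) → ΣL xs (λ x → c * h x) ≡ c * ΣL xs h
  ΣL-* []       c h = sym (ℚP.*-zeroʳ c)
  ΣL-* (x ∷ xs) c h rewrite ΣL-* xs c h = sym (ℚP.*-distribˡ-+ c (h x) _)

  ΣL-0 : (xs : List A) → ΣL xs (λ _ → 0ℚ) ≡ 0ℚ
  ΣL-0 []       = refl
  ΣL-0 (x ∷ xs) = trans (ℚP.+-identityˡ _) (ΣL-0 xs)

ΣL-map : {A B : Set} (g : A → B) (xs : List A) (h : B → ℚ) → ΣL (map g xs) h ≡ ΣL xs (h ∘ g)
ΣL-map g []       h = refl
ΣL-map g (x ∷ xs) h = cong (h (g x) +_) (ΣL-map g xs h)

ΣL-concatMap : {A B : Set} (F : A → List B) (xs : List A) (h : B → ℚ) →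
  ΣL (concatMap F xs) h ≡ ΣL xs (λ x → ΣL (F x) h)
ΣL-concatMap F []       h = refl
ΣL-concatMap F (x ∷ xs) h =
  trans (ΣL-++ (F x) (concatMap F xs) h) (cong (ΣL (F x) h +_) (ΣL-concatMap F xs h))

ΣL-swap : {A B : Set} (xs : List A) (ys : List B) (h : A → B → ℚ) →
  ΣL xs (λ x → ΣL ys (h x)) ≡ ΣL ys (λ y → ΣL xs (λ x → h x y))
ΣL-swap []       ys h = sym (ΣL-0 ys)
ΣL-swap (x ∷ xs) ys h =
  trans (cong (ΣL ys (h x) +_) (ΣL-swap xs ys h)) (sym (ΣL-+ ys (h x) (λ y → ΣL xs (λ x' → h x' y))))

isYes-true : {A : Set} (a? : Dec A) → A → ⌊ a? ⌋ ≡ true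
isYes-true a? a = trans (isYes≗does a?) (dec-true a? a)

isYes-false : {A : Set} (a? : Dec A) → ¬ A → ⌊ a? ⌋ ≡ false
isYes-false a? ¬a = trans (isYes≗does a?) (dec-false a? ¬a)

tst : List ℕ → List ℕ → Bool
tst f e = ⌊ ≡-dec ℕ._≟_ f e ⌋

tst-refl : (f : List ℕ) → tst f f ≡ true
tst-refl f = isYes-true (≡-dec ℕ._≟_ f f) refl

tst-no : {f e : List ℕ} → ¬ f ≡ e → tst f e ≡ false
tst-no {f} {e} = isYes-false (≡-dec ℕ._≟_ f e)

δ : List ℕ → List ℕ → ℚ → ℚ
δ f e c = if tst f e then c else 0ℚ

co : Poly → List ℕ → ℚ
co P e = ΣL P (λ t → δ (proj₂ t) e (proj₁ t))

coeff≡co : (P : Poly) (e : List ℕ) → coeff P e ≡ co P e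
coeff≡co []            e = refl
coeff≡co ((c , f) ∷ P) e with ≡-dec ℕ._≟_ f e
... | yes _ = cong (c +_) (coeff≡co P e)
... | no  _ = trans (coeff≡co P e) (sym (ℚP.+-identityˡ _))

infix 4 _≋_
_≋_ : Poly → Poly → Set
P ≋ Q = ∀ e → co P e ≡ co Q e

δ-* : (f e : List ℕ) (c d : ℚ) → δ f e (c * d) ≡ c * δ f e d
δ-* f e c d with tst f e
... | true  = refl
... | false = sym (ℚP.*-zeroʳ c)

monomial : List ℕ → Poly
monomial f = (1ℚ , f) ∷ []

δ-single : (f e : List ℕ) (c : ℚ) → co ((c , f) ∷ []) e ≡ δ f e c
δ-single f e c = ℚP.+-identityʳ _

co-++ : (p q : Poly) (e : List ℕ) → co (p ++ q) e ≡ co p e + co q e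
co-++ p q e = ΣL-++ p q _

co-scale : (c : ℚ) (p : Poly) (e : List ℕ) → co (scaleP c p) e ≡ c * co p e
co-scale c p e =
  trans (ΣL-map _ p _) (trans (ΣL-cong p (λ t → δ-* (proj₂ t) e c (proj₁ t))) (ΣL-* p c _))

co-subP : (p q : Poly) (e : List ℕ) → co (p -P q) e ≡ co p e + - 1ℚ * co q e
co-subP p q e = trans (co-++ p (negP q) e) (cong (co p e +_) (co-scale (- 1ℚ) q e))

co-sumP : {A : Set} (r : ℕ) (F : A → Poly) (ts : List A) (e : List ℕ) →
  co (sumP r (map F ts)) e ≡ ΣL ts (λ t → co (F t) e)
co-sumP r F []       e = refl
co-sumP r F (t ∷ ts) e = trans (co-++ (F t) _ e) (cong (co (F t) e +_) (co-sumP r F ts e))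

_+ₑ_ : List ℕ → List ℕ → List ℕ
f +ₑ g = zipWith ℕ._+_ f g

+ₑ-comm : (f g : List ℕ) → f +ₑ g ≡ g +ₑ f
+ₑ-comm f g = LP.zipWith-comm ℕ._+_ ℕP.+-comm f g

co-mul : (p q : Poly) (e : List ℕ) →
  co (mulP p q) e ≡ ΣL p (λ s → ΣL q (λ t → δ (proj₂ s +ₑ proj₂ t) e (proj₁ s * proj₁ t)))
co-mul p q e = trans (ΣL-concatMap _ p _) (ΣL-cong p (λ s → ΣL-map _ q _))

mulP-comm : (p q : Poly) → mulP p q ≋ mulP q p
mulP-comm p q e =
  trans (co-mul p q e)
  (trans (ΣL-swap p q _)
  (trans (ΣL-cong q (λ t → ΣL-cong p (λ s →
           cong₂ (λ x y → δ x e y) (+ₑ-comm (proj₂ s) (proj₂ t)) (ℚP.*-comm (proj₁ s) (proj₁ t)))))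
  (sym (co-mul q p e))))

-- Well-formed polynomials: all exponent lists have length n.  This is
-- needed because exponent vectors are added with zipWith, which would
-- silently truncate lists of different lengths.

WF : ℕ → Poly → Set
WF n p = All (λ t → length (proj₂ t) ≡ n) p

WF-++ : {n : ℕ} {p q : Poly} → WF n p → WF n q → WF n (p ++ q)
WF-++ = AllP.++⁺

WF-scale : {n : ℕ} (c : ℚ) {p : Poly} → WF n p → WF n (scaleP c p)
WF-scale c []       = []
WF-scale c (l ∷ wp) = l ∷ WF-scale c wp

WF-sub : {n : ℕ} {p q : Poly} → WF n p → WF n q → WF n (p -P q)
WF-sub wp wq = WF-++ wp (WF-scale (- 1ℚ) wq)

length-+ₑ : (n : ℕ) (f g : List ℕ) → length f ≡ n → length g ≡ n → length (f +ₑ g) ≡ n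
length-+ₑ n f g lf lg = trans (LP.length-zipWith ℕ._+_ f g) (trans (cong₂ ℕ._⊓_ lf lg) (ℕP.⊓-idem n))

WF-mul : {n : ℕ} {p q : Poly} → WF n p → WF n q → WF n (mulP p q)
WF-mul {n} {[]}    {q} []       wq = []
WF-mul {n} {s ∷ p} {q} (l ∷ wp) wq = WF-++ (row q wq) (WF-mul wp wq)
  where
  row : (q : Poly) → WF n q → WF n (map (λ { (d , f) → (proj₁ s * d , zipWith ℕ._+_ (proj₂ s) f) }) q)
  row []      []        = []
  row (t ∷ q) (l' ∷ wq) = length-+ₑ n (proj₂ s) (proj₂ t) l l' ∷ row q wq

length-unitExp : (n k : ℕ) → length (unitExp n k) ≡ n
length-unitExp zero    k       = refl
length-unitExp (suc n) zero    = cong suc (LP.length-replicate n)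
length-unitExp (suc n) (suc k) = cong suc (length-unitExp n k)

WF-var : (n k : ℕ) → WF n (var n k)
WF-var n k = length-unitExp n k ∷ []

WF-const : (n : ℕ) (c : ℚ) → WF n (constP n c)
WF-const n c = LP.length-replicate n ∷ []

WF-pow : {n : ℕ} {p : Poly} (a : ℕ) → WF n p → WF n (powP n p a)
WF-pow zero    wp = WF-const _ _
WF-pow (suc a) wp = WF-mul wp (WF-pow a wp)

WF-evalMon : {n : ℕ} (e : List ℕ) (args : List Poly) → All (WF n) args → WF n (evalMon n e args)
WF-evalMon []      args     wa        = WF-const _ _
WF-evalMon (a ∷ e) []       wa        = []
WF-evalMon (a ∷ e) (p ∷ ps) (wp ∷ wa) = WF-mul (WF-pow a wp) (WF-evalMon e ps wa)

-- The coefficient of x^e in (c·x^f)·q is c times the coefficient of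
-- x^{e-f} in q (zero if e - f has a negative entry).  Since this only
-- depends on the coefficients of q, multiplication is a congruence for ≋.

divExp : List ℕ → List ℕ → Maybe (List ℕ)
divExp []      []       = just []
divExp []      (_ ∷ _)  = nothing
divExp (_ ∷ _) []       = nothing
divExp (a ∷ f) (x ∷ xs) with a ≤? x
... | yes _ = Maybe.map ((x ∸ a) ∷_) (divExp f xs)
... | no  _ = nothing

divExp-complete : (f g x : List ℕ) → length g ≡ length f → f +ₑ g ≡ x → divExp f x ≡ just g
divExp-complete []      []      .[] refl refl = refl
divExp-complete (a ∷ f) (b ∷ g) .(a ℕ.+ b ∷ f +ₑ g) eq refl with a ≤? a ℕ.+ b
... | yes _ rewrite divExp-complete f g (f +ₑ g) (ℕP.suc-injective eq) refl | ℕP.m+n∸m≡n a b = refl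
... | no a≰ = ⊥-elim (a≰ (ℕP.m≤m+n a b))

divExp-sound : (f x g : List ℕ) → divExp f x ≡ just g → f +ₑ g ≡ x
divExp-sound []      []       .[] refl = refl
divExp-sound []      (_ ∷ _)  g ()
divExp-sound (_ ∷ _) []       g ()
divExp-sound (a ∷ f) (x ∷ xs) g h with a ≤? x
divExp-sound (a ∷ f) (x ∷ xs) g h | yes a≤x with divExp f xs in eq
divExp-sound (a ∷ f) (x ∷ xs) .(x ∸ a ∷ g') refl | yes a≤x | just g' =
  cong₂ _∷_ (ℕP.m+[n∸m]≡n a≤x) (divExp-sound f xs g' eq)
divExp-sound (a ∷ f) (x ∷ xs) g () | yes a≤x | nothing
divExp-sound (a ∷ f) (x ∷ xs) g () | no _

just-injective : {A : Set} {a b : A} → just a ≡ just b → a ≡ b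
just-injective refl = refl

tst-divExp : (f g x : List ℕ) → length g ≡ length f →
  tst (f +ₑ g) x ≡ maybe (tst g) false (divExp f x)
tst-divExp f g x len with divExp f x in eq
... | nothing = tst-no (λ h → nothing≢just (trans (sym eq) (divExp-complete f g x len h)))
  where
  nothing≢just : ¬ (nothing ≡ just g)
  nothing≢just ()
... | just y with ≡-dec ℕ._≟_ g y
...   | yes refl = trans (cong (λ z → tst z x) (divExp-sound f x g eq)) (tst-refl x)
...   | no g≢y   = tst-no (λ h → g≢y (sym (just-injective (trans (sym eq) (divExp-complete f g x len h)))))

δ-divExp : (f g x : List ℕ) (c d : ℚ) → length g ≡ length f →
  δ (f +ₑ g) x (c * d) ≡ c * maybe (λ y → δ g y d) 0ℚ (divExp f x)
δ-divExp f g x c d len with divExp f x | tst-divExp f g x len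
... | nothing | h rewrite h = sym (ℚP.*-zeroʳ c)
... | just y  | h rewrite h = δ-* g y c d

ΣL-maybe : {A : Set} (q : List A) (s : Maybe (List ℕ)) (h : A → List ℕ → ℚ) →
  ΣL q (λ t → maybe (h t) 0ℚ s) ≡ maybe (λ y → ΣL q (λ t → h t y)) 0ℚ s
ΣL-maybe q nothing  h = ΣL-0 q
ΣL-maybe q (just y) h = refl

co-termMul : (n : ℕ) (f e : List ℕ) (c : ℚ) (q : Poly) → length f ≡ n → WF n q →
  ΣL q (λ t → δ (f +ₑ proj₂ t) e (c * proj₁ t)) ≡ c * maybe (co q) 0ℚ (divExp f e)
co-termMul n f e c q lf wq =
  trans (ΣL-congAll (termwise q wq))
  (trans (ΣL-* q c _) (cong (c *_) (ΣL-maybe q (divExp f e) (λ t y → δ (proj₂ t) y (proj₁ t)))))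
  where
  termwise : (q : Poly) → WF n q →
    All (λ t → δ (f +ₑ proj₂ t) e (c * proj₁ t)
             ≡ c * maybe (λ y → δ (proj₂ t) y (proj₁ t)) 0ℚ (divExp f e)) q
  termwise []      []       = []
  termwise (t ∷ q) (l ∷ wq) = δ-divExp f (proj₂ t) e c (proj₁ t) (trans l (sym lf)) ∷ termwise q wq

mul-congʳ : (n : ℕ) (p q q' : Poly) → WF n p → WF n q → WF n q' → q ≋ q' → mulP p q ≋ mulP p q'
mul-congʳ n p q q' wp wq wq' q≋q' e =
  trans (co-mul p q e) (trans (ΣL-congAll (termwise p wp)) (sym (co-mul p q' e)))
  where
  maybe-co : (m : Maybe (List ℕ)) → maybe (co q) 0ℚ m ≡ maybe (co q') 0ℚ m
  maybe-co nothing  = refl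
  maybe-co (just y) = q≋q' y
  termwise : (p : Poly) → WF n p →
    All (λ s → ΣL q  (λ t → δ (proj₂ s +ₑ proj₂ t) e (proj₁ s * proj₁ t))
             ≡ ΣL q' (λ t → δ (proj₂ s +ₑ proj₂ t) e (proj₁ s * proj₁ t))) p
  termwise []      []       = []
  termwise (s ∷ p) (l ∷ wp) =
    trans (co-termMul n (proj₂ s) e (proj₁ s) q l wq)
    (trans (cong (proj₁ s *_) (maybe-co (divExp (proj₂ s) e)))
    (sym (co-termMul n (proj₂ s) e (proj₁ s) q' l wq'))) ∷ termwise p wp

mul-congˡ : (n : ℕ) (p p' q : Poly) → WF n p → WF n p' → WF n q → p ≋ p' → mulP p q ≋ mulP p' q
mul-congˡ n p p' q wp wp' wq p≋p' e =
  trans (mulP-comm p q e) (trans (mul-congʳ n q p p' wq wp wp' p≋p' e) (mulP-comm q p' e))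

mul-scaleˡ : (c : ℚ) (p q : Poly) (e : List ℕ) → co (mulP (scaleP c p) q) e ≡ c * co (mulP p q) e
mul-scaleˡ c p q e =
  trans (co-mul (scaleP c p) q e)
  (trans (ΣL-map _ p _)
  (trans (ΣL-cong p (λ s → trans (ΣL-cong q (λ t →
            trans (cong (δ _ e) (ℚP.*-assoc c (proj₁ s) (proj₁ t))) (δ-* _ e c _)))
          (ΣL-* q c _)))
  (trans (ΣL-* p c _) (cong (c *_) (sym (co-mul p q e))))))

mul-scaleʳ : (c : ℚ) (p q : Poly) (e : List ℕ) → co (mulP p (scaleP c q)) e ≡ c * co (mulP p q) e
mul-scaleʳ c p q e =
  trans (mulP-comm p _ e) (trans (mul-scaleˡ c q p e) (cong (c *_) (mulP-comm q p e)))

pow-cong : (n : ℕ) (Z Z' : Poly) → WF n Z → WF n Z' → Z ≋ Z' → (a : ℕ) → powP n Z a ≋ powP n Z' a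
pow-cong n Z Z' wZ wZ' Z≋Z' zero    e = refl
pow-cong n Z Z' wZ wZ' Z≋Z' (suc a) e =
  trans (mul-congˡ n Z Z' _ wZ wZ' (WF-pow a wZ) Z≋Z' e)
        (mul-congʳ n Z' _ _ wZ' (WF-pow a wZ) (WF-pow a wZ') (pow-cong n Z Z' wZ wZ' Z≋Z' a) e)

pow-neg : (n : ℕ) (Z : Poly) → WF n Z → (a : ℕ) → powP n (negP Z) a ≋ scaleP (negOnePow a) (powP n Z a)
pow-neg n Z wZ zero    e = sym (trans (co-scale 1ℚ (constP n 1ℚ) e) (ℚP.*-identityˡ _))
pow-neg n Z wZ (suc a) e = begin
  co (mulP (negP Z) (powP n (negP Z) a)) e
    ≡⟨ mul-scaleˡ (- 1ℚ) Z _ e ⟩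
  - 1ℚ * co (mulP Z (powP n (negP Z) a)) e
    ≡⟨ cong (- 1ℚ *_) (mul-congʳ n Z _ _ wZ (WF-pow a (WF-scale (- 1ℚ) wZ))
                          (WF-scale s (WF-pow a wZ)) (pow-neg n Z wZ a) e) ⟩
  - 1ℚ * co (mulP Z (scaleP s (powP n Z a))) e
    ≡⟨ cong (- 1ℚ *_) (mul-scaleʳ s Z (powP n Z a) e) ⟩
  - 1ℚ * (s * co (mulP Z (powP n Z a)) e)
    ≡⟨ solve 2 (λ s x → con (- 1ℚ) :* (s :* x) := (:- s) :* x) refl s _ ⟩
  - s * co (mulP Z (powP n Z a)) e
    ≡⟨ sym (co-scale (- s) (mulP Z (powP n Z a)) e) ⟩
  co (scaleP (- s) (mulP Z (powP n Z a))) e ∎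
  where
  open ≡-Reasoning
  s : ℚ
  s = negOnePow a

negOnePow² : (a : ℕ) → negOnePow a * negOnePow a ≡ 1ℚ
negOnePow² zero    = refl
negOnePow² (suc a) = trans (solve 1 (λ s → (:- s) :* (:- s) := s :* s) refl (negOnePow a)) (negOnePow² a)

sub-antisym : (X Y : Poly) → X -P Y ≋ negP (Y -P X)
sub-antisym X Y e =
  trans (co-subP X Y e)
  (trans (solve 2 (λ x y → x :+ con (- 1ℚ) :* y := con (- 1ℚ) :* (y :+ con (- 1ℚ) :* x)) refl (co X e) (co Y e))
  (sym (trans (co-scale (- 1ℚ) (Y -P X) e) (cong (- 1ℚ *_) (co-subP Y X e)))))

sign-rule : (n : ℕ) (X Y : Poly) → WF n X → WF n Y → (a : ℕ) (b : List ℕ) (R : List Poly) → All (WF n) R →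
  ∀ e → negOnePow a * co (evalMon n (a ∷ b) ((X -P Y) ∷ R)) e ≡ co (evalMon n (a ∷ b) ((Y -P X) ∷ R)) e
sign-rule n X Y wX wY a b R wR e = begin
  s * co (mulP (powP n (X -P Y) a) W) e
    ≡⟨ cong (s *_) (mul-congˡ n _ _ W (WF-pow a wXY) (WF-scale s (WF-pow a wYX)) wW pow-flip e) ⟩
  s * co (mulP (scaleP s (powP n YX a)) W) e
    ≡⟨ cong (s *_) (mul-scaleˡ s (powP n YX a) W e) ⟩
  s * (s * co (mulP (powP n YX a) W) e)
    ≡⟨ sym (ℚP.*-assoc s s _) ⟩
  (s * s) * co (mulP (powP n YX a) W) e
    ≡⟨ cong (_* co (mulP (powP n YX a) W) e) (negOnePow² a) ⟩
  1ℚ * co (mulP (powP n YX a) W) e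
    ≡⟨ ℚP.*-identityˡ _ ⟩
  co (mulP (powP n YX a) W) e ∎
  where
  open ≡-Reasoning
  s : ℚ
  s = negOnePow a
  YX W : Poly
  YX = Y -P X
  W  = evalMon n b R
  wW : WF n W
  wW = WF-evalMon b R wR
  wXY : WF n (X -P Y)
  wXY = WF-sub wX wY
  wYX : WF n YX
  wYX = WF-sub wY wX
  pow-flip : powP n (X -P Y) a ≋ scaleP s (powP n YX a)
  pow-flip e' = trans (pow-cong n (X -P Y) (negP YX) wXY (WF-scale (- 1ℚ) wYX) (sub-antisym X Y) a e')
                      (pow-neg n YX wYX a e')

shift : Poly → Poly
shift = map (λ t → (proj₁ t , 0 ∷ proj₂ t))

shiftN : ℕ → Poly → Poly
shiftN zero    P = P
shiftN (suc k) P = shift (shiftN k P)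

shift-scale : (c : ℚ) (p : Poly) → shift (scaleP c p) ≡ scaleP c (shift p)
shift-scale c []      = refl
shift-scale c (t ∷ p) = cong (_ ∷_) (shift-scale c p)

shift-mul : (p q : Poly) → shift (mulP p q) ≡ mulP (shift p) (shift q)
shift-mul []      q = refl
shift-mul (s ∷ p) q = trans (LP.map-++ _ _ (mulP p q)) (cong₂ _++_ (row q) (shift-mul p q))
  where
  row : (q : Poly) → shift (map (λ { (d , f) → (proj₁ s * d , zipWith ℕ._+_ (proj₂ s) f) }) q)
                   ≡ map (λ { (d , f) → (proj₁ s * d , zipWith ℕ._+_ (0 ∷ proj₂ s) f) }) (shift q)
  row []      = refl
  row (t ∷ q) = cong (_ ∷_) (row q)

shift-pow : (n : ℕ) (p : Poly) (a : ℕ) → powP (suc n) (shift p) a ≡ shift (powP n p a)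
shift-pow n p zero    = refl
shift-pow n p (suc a) = trans (cong (mulP (shift p)) (shift-pow n p a)) (sym (shift-mul p (powP n p a)))

shift-evalMon : (n : ℕ) (e : List ℕ) (ps : List Poly) → evalMon (suc n) e (map shift ps) ≡ shift (evalMon n e ps)
shift-evalMon n []      ps       = refl
shift-evalMon n (a ∷ e) []       = refl
shift-evalMon n (a ∷ e) (p ∷ ps) =
  trans (cong₂ mulP (shift-pow n p a) (shift-evalMon n e ps)) (sym (shift-mul (powP n p a) (evalMon n e ps)))

WF-shift : {n : ℕ} {p : Poly} → WF n p → WF (suc n) (shift p)
WF-shift []       = []
WF-shift (l ∷ wp) = cong suc l ∷ WF-shift wp

WF-shiftN : {n : ℕ} (k : ℕ) {p : Poly} → WF n p → WF (k ℕ.+ n) (shiftN k p)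
WF-shiftN zero    wp = wp
WF-shiftN (suc k) wp = WF-shift (WF-shiftN k wp)

shiftN-sub : (k : ℕ) (p q : Poly) → shiftN k (p -P q) ≡ shiftN k p -P shiftN k q
shiftN-sub zero    p q = refl
shiftN-sub (suc k) p q =
  trans (cong shift (shiftN-sub k p q))
  (trans (LP.map-++ _ (shiftN k p) _) (cong (shift (shiftN k p) ++_) (shift-scale (- 1ℚ) (shiftN k q))))

shiftN-var : (k j i : ℕ) → var (k ℕ.+ j) (k ℕ.+ i) ≡ shiftN k (var j i)
shiftN-var zero    j i = refl
shiftN-var (suc k) j i = cong shift (shiftN-var k j i)

map-shiftN-suc : (k : ℕ) (ps : List Poly) → map (shiftN (suc k)) ps ≡ map shift (map (shiftN k) ps)
map-shiftN-suc k ps = LP.map-∘ ps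

-- Φ pre h e is h (rest) if e = pre ++ rest and 0 otherwise: it is the
-- coefficient functional of "x^pre times a polynomial with coefficients h"
-- in the trailing variables.

Ψ : ℕ → (List ℕ → ℚ) → List ℕ → ℚ
Ψ a h []      = 0ℚ
Ψ a h (x ∷ y) = if ⌊ a ℕ.≟ x ⌋ then h y else 0ℚ

Φ : List ℕ → (List ℕ → ℚ) → List ℕ → ℚ
Φ []        h = h
Φ (a ∷ pre) h = Ψ a (Φ pre h)

Ψ-cong : (a : ℕ) {h k : List ℕ → ℚ} → (∀ y → h y ≡ k y) → ∀ e → Ψ a h e ≡ Ψ a k e
Ψ-cong a eq []      = refl
Ψ-cong a eq (x ∷ y) with ⌊ a ℕ.≟ x ⌋
... | true  = eq y
... | false = refl

Ψ-+ : (a : ℕ) (h k : List ℕ → ℚ) → ∀ e → Ψ a (λ y → h y + k y) e ≡ Ψ a h e + Ψ a k e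
Ψ-+ a h k []      = refl
Ψ-+ a h k (x ∷ y) with ⌊ a ℕ.≟ x ⌋
... | true  = refl
... | false = refl

Ψ-* : (a : ℕ) (c : ℚ) (h : List ℕ → ℚ) → ∀ e → Ψ a (λ y → c * h y) e ≡ c * Ψ a h e
Ψ-* a c h []      = sym (ℚP.*-zeroʳ c)
Ψ-* a c h (x ∷ y) with ⌊ a ℕ.≟ x ⌋
... | true  = refl
... | false = sym (ℚP.*-zeroʳ c)

Ψ-0 : (a : ℕ) → ∀ e → Ψ a (λ _ → 0ℚ) e ≡ 0ℚ
Ψ-0 a []      = refl
Ψ-0 a (x ∷ y) with ⌊ a ℕ.≟ x ⌋
... | true  = refl
... | false = refl

Φ-cong : (pre : List ℕ) {h k : List ℕ → ℚ} → (∀ y → h y ≡ k y) → ∀ e → Φ pre h e ≡ Φ pre k e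
Φ-cong []        eq = eq
Φ-cong (a ∷ pre) eq = Ψ-cong a (Φ-cong pre eq)

Φ-+ : (pre : List ℕ) (h k : List ℕ → ℚ) → ∀ e → Φ pre (λ y → h y + k y) e ≡ Φ pre h e + Φ pre k e
Φ-+ []        h k e = refl
Φ-+ (a ∷ pre) h k e = trans (Ψ-cong a (Φ-+ pre h k) e) (Ψ-+ a (Φ pre h) (Φ pre k) e)

Φ-* : (pre : List ℕ) (c : ℚ) (h : List ℕ → ℚ) → ∀ e → Φ pre (λ y → c * h y) e ≡ c * Φ pre h e
Φ-* []        c h e = refl
Φ-* (a ∷ pre) c h e = trans (Ψ-cong a (Φ-* pre c h) e) (Ψ-* a c (Φ pre h) e)

Φ-0 : (pre : List ℕ) → ∀ e → Φ pre (λ _ → 0ℚ) e ≡ 0ℚ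
Φ-0 []        e = refl
Φ-0 (a ∷ pre) e = trans (Ψ-cong a (Φ-0 pre) e) (Ψ-0 a e)

Φ-ΣL : {A : Set} (pre : List ℕ) (xs : List A) (h : A → List ℕ → ℚ) → ∀ e →
  Φ pre (λ y → ΣL xs (λ x → h x y)) e ≡ ΣL xs (λ x → Φ pre (h x) e)
Φ-ΣL pre []       h e = Φ-0 pre e
Φ-ΣL pre (x ∷ xs) h e =
  trans (Φ-+ pre (h x) (λ y → ΣL xs (λ x' → h x' y)) e) (cong (Φ pre (h x) e +_) (Φ-ΣL pre xs h e))

tst-cons : (a x : ℕ) (g y : List ℕ) → tst (a ∷ g) (x ∷ y) ≡ (⌊ a ℕ.≟ x ⌋ ∧ tst g y)
tst-cons a x g y = by-cases (a ℕ.≟ x) (≡-dec ℕ._≟_ g y)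
  where
  by-cases : Dec (a ≡ x) → Dec (g ≡ y) → tst (a ∷ g) (x ∷ y) ≡ (⌊ a ℕ.≟ x ⌋ ∧ tst g y)
  by-cases (yes refl) (yes refl) =
    trans (tst-refl (a ∷ g)) (sym (cong₂ _∧_ (isYes-true (a ℕ.≟ a) refl) (tst-refl g)))
  by-cases (yes refl) (no g≢y) =
    trans (tst-no (λ h → g≢y (LP.∷-injectiveʳ h))) (sym (cong₂ _∧_ (isYes-true (a ℕ.≟ a) refl) (tst-no g≢y)))
  by-cases (no a≢x) _ =
    trans (tst-no (λ h → a≢x (LP.∷-injectiveˡ h))) (sym (cong (_∧ tst g y) (isYes-false (a ℕ.≟ x) a≢x)))

δ-cons : (a : ℕ) (g e : List ℕ) (d : ℚ) → δ (a ∷ g) e d ≡ Ψ a (λ y → δ g y d) e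
δ-cons a g []      d = refl
δ-cons a g (x ∷ y) d rewrite tst-cons a x g y with ⌊ a ℕ.≟ x ⌋
... | true  = refl
... | false = refl

Φ-take : (pre : List ℕ) (h : List ℕ → ℚ) (e : List ℕ) →
  Φ pre h e ≡ (if tst pre (take (length pre) e) then h (drop (length pre) e) else 0ℚ)
Φ-take []        h e       rewrite tst-refl [] = refl
Φ-take (a ∷ pre) h []      rewrite tst-no {a ∷ pre} {[]} (λ ()) = refl
Φ-take (a ∷ pre) h (x ∷ y) rewrite tst-cons a x pre (take (length pre) y) with ⌊ a ℕ.≟ x ⌋
... | true  = Φ-take pre h y
... | false = refl

single-Φ : (pre ab : List ℕ) → ∀ e → co (monomial (pre ++ ab)) e ≡ Φ pre (co (monomial ab)) e
single-Φ []        ab e = refl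
single-Φ (a ∷ pre) ab e =
  trans (δ-single (a ∷ pre ++ ab) e 1ℚ)
  (trans (δ-cons a (pre ++ ab) e 1ℚ)
  (Ψ-cong a (λ y → trans (sym (δ-single (pre ++ ab) y 1ℚ)) (single-Φ pre ab y)) e))

vars : ℕ → List Poly
vars n = map (var n) (upTo n)

WF-vars : (n : ℕ) → All (WF n) (vars n)
WF-vars n = AllP.map⁺ (All.universal (WF-var n) (upTo n))

vars-suc : (n : ℕ) → vars (suc n) ≡ var (suc n) 0 ∷ map shift (vars n)
vars-suc n = cong (var (suc n) 0 ∷_) (shifted (λ i → i) n)
  where
  shifted : (g : ℕ → ℕ) (k : ℕ) →
    map (var (suc n)) (L.applyUpTo (λ i → suc (g i)) k) ≡ map shift (map (var n) (L.applyUpTo g k))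
  shifted g zero    = refl
  shifted g (suc k) = cong (shift (var n (g 0)) ∷_) (shifted (λ i → g (suc i)) k)

pow-var0 : (n a : ℕ) → powP (suc n) (var (suc n) 0) a ≡ (1ℚ , a ∷ replicate n 0) ∷ []
pow-var0 n zero    = refl
pow-var0 n (suc a) rewrite pow-var0 n a =
  cong (λ z → (1ℚ , suc a ∷ z) ∷ []) (LP.zipWith-replicate n ℕ._+_ 0 0)

replicate0-+ₑ : (n : ℕ) (g : List ℕ) → length g ≡ n → replicate n 0 +ₑ g ≡ g
replicate0-+ₑ zero    []      refl = refl
replicate0-+ₑ (suc n) (b ∷ g) l    = cong (b ∷_) (replicate0-+ₑ n g (ℕP.suc-injective l))

co-x₁-pow-shift : (n a : ℕ) (Z : Poly) → WF n Z →
  ∀ e → co (mulP (powP (suc n) (var (suc n) 0) a) (shift Z)) e ≡ Ψ a (co Z) e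
co-x₁-pow-shift n a Z wZ e rewrite pow-var0 n a =
  trans (co-mul ((1ℚ , a ∷ replicate n 0) ∷ []) (shift Z) e)
  (trans (ℚP.+-identityʳ _)
  (trans (ΣL-map _ Z _)
  (trans (ΣL-congAll (termwise Z wZ))
  (sym (Φ-ΣL (a ∷ []) Z (λ t y → δ (proj₂ t) y (proj₁ t)) e)))))
  where
  termwise : (Z : Poly) → WF n Z →
    All (λ t → δ ((a ∷ replicate n 0) +ₑ (0 ∷ proj₂ t)) e (1ℚ * proj₁ t)
             ≡ Ψ a (λ y → δ (proj₂ t) y (proj₁ t)) e) Z
  termwise []      []       = []
  termwise (t ∷ Z) (l ∷ wZ) =
    trans (cong₂ (λ u v → δ u e v) (cong₂ _∷_ (ℕP.+-identityʳ a) (replicate0-+ₑ n (proj₂ t) l))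
                                   (ℚP.*-identityˡ _))
          (δ-cons a (proj₂ t) e (proj₁ t)) ∷ termwise Z wZ

evalMon-vars : (n : ℕ) (ab : List ℕ) → length ab ≡ n → evalMon n ab (vars n) ≋ monomial ab
evalMon-vars zero    []       refl e = refl
evalMon-vars (suc n) (a ∷ ab) l    e = begin
  co (evalMon (suc n) (a ∷ ab) (vars (suc n))) e
    ≡⟨ cong (λ z → co (evalMon (suc n) (a ∷ ab) z) e) (vars-suc n) ⟩
  co (mulP (powP (suc n) (var (suc n) 0) a) (evalMon (suc n) ab (map shift (vars n)))) e
    ≡⟨ cong (λ z → co (mulP (powP (suc n) (var (suc n) 0) a) z) e) (shift-evalMon n ab (vars n)) ⟩
  co (mulP (powP (suc n) (var (suc n) 0) a) (shift (evalMon n ab (vars n)))) e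
    ≡⟨ co-x₁-pow-shift n a (evalMon n ab (vars n)) (WF-evalMon ab (vars n) (WF-vars n)) e ⟩
  Ψ a (co (evalMon n ab (vars n))) e
    ≡⟨ Ψ-cong a (λ y → trans (evalMon-vars n ab (ℕP.suc-injective l) y) (δ-single ab y 1ℚ)) e ⟩
  Ψ a (λ y → δ ab y 1ℚ) e
    ≡⟨ sym (trans (δ-single (a ∷ ab) e 1ℚ) (δ-cons a ab e 1ℚ)) ⟩
  co (monomial (a ∷ ab)) e ∎
  where open ≡-Reasoning

prefixVars : ℕ → ℕ → List Poly
prefixVars zero    j = []
prefixVars (suc p) j = var (suc (p ℕ.+ j)) 0 ∷ map shift (prefixVars p j)

length-prefixVars : (p j : ℕ) → length (prefixVars p j) ≡ p
length-prefixVars zero    j = refl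
length-prefixVars (suc p) j = cong suc (trans (LP.length-map shift (prefixVars p j)) (length-prefixVars p j))

WF-prefixVars : (p j : ℕ) → All (WF (p ℕ.+ j)) (prefixVars p j)
WF-prefixVars zero    j = []
WF-prefixVars (suc p) j = WF-var (suc (p ℕ.+ j)) 0 ∷ AllP.map⁺ (All.map WF-shift (WF-prefixVars p j))

vars-split : (p j : ℕ) → vars (p ℕ.+ j) ≡ prefixVars p j ++ map (shiftN p) (vars j)
vars-split zero    j = sym (LP.map-id (vars j))
vars-split (suc p) j =
  trans (vars-suc (p ℕ.+ j))
  (cong (var (suc (p ℕ.+ j)) 0 ∷_)
  (trans (cong (map shift) (vars-split p j))
  (trans (LP.map-++ shift (prefixVars p j) _)
         (cong (map shift (prefixVars p j) ++_) (sym (map-shiftN-suc p (vars j)))))))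

evalMon-prefix : (p j : ℕ) (pre ab : List ℕ) → length pre ≡ p → (Y : List Poly) → All (WF j) Y →
  ∀ e → co (evalMon (p ℕ.+ j) (pre ++ ab) (prefixVars p j ++ map (shiftN p) Y)) e
      ≡ Φ pre (co (evalMon j ab Y)) e
evalMon-prefix zero    j []        ab l Y wY e = cong (λ z → co (evalMon j ab z) e) (LP.map-id Y)
evalMon-prefix (suc p) j (a ∷ pre) ab l Y wY e = begin
  co (evalMon n' (a ∷ pre ++ ab) (var n' 0 ∷ map shift (prefixVars p j) ++ map (shiftN (suc p)) Y)) e
    ≡⟨ cong (λ z → co (evalMon n' (a ∷ pre ++ ab) (var n' 0 ∷ z)) e) args-shifted ⟩
  co (mulP (powP n' (var n' 0) a) (evalMon n' (pre ++ ab) (map shift L))) e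
    ≡⟨ cong (λ z → co (mulP (powP n' (var n' 0) a) z) e) (shift-evalMon (p ℕ.+ j) (pre ++ ab) L) ⟩
  co (mulP (powP n' (var n' 0) a) (shift (evalMon (p ℕ.+ j) (pre ++ ab) L))) e
    ≡⟨ co-x₁-pow-shift (p ℕ.+ j) a _ wEval e ⟩
  Ψ a (co (evalMon (p ℕ.+ j) (pre ++ ab) L)) e
    ≡⟨ Ψ-cong a (evalMon-prefix p j pre ab (ℕP.suc-injective l) Y wY) e ⟩
  Ψ a (Φ pre (co (evalMon j ab Y))) e ∎
  where
  open ≡-Reasoning
  n' : ℕ
  n' = suc (p ℕ.+ j)
  L : List Poly
  L = prefixVars p j ++ map (shiftN p) Y
  wEval : WF (p ℕ.+ j) (evalMon (p ℕ.+ j) (pre ++ ab) L)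
  wEval = WF-evalMon (pre ++ ab) L
            (AllP.++⁺ (WF-prefixVars p j) (AllP.map⁺ (All.map (WF-shiftN p) wY)))
  args-shifted : map shift (prefixVars p j) ++ map (shiftN (suc p)) Y ≡ map shift L
  args-shifted = trans (cong (map shift (prefixVars p j) ++_) (map-shiftN-suc p Y))
                       (sym (LP.map-++ shift (prefixVars p j) _))

-- phiAt r p j is φ^{(j)} on polynomials in r variables with the number
-- r - j of untouched leading variables abstracted to p; phiPoly r j is
-- definitionally phiAt r (r ∸ j) j, which is how it is used below.

diffAt : ℕ → ℕ → ℕ → Poly
diffAt r p t = var r (p ℕ.+ t) -P var r (p ℕ.+ t ∸ 1)

substArgs : ℕ → ℕ → ℕ → ℕ → List Poly
substArgs r p t i = take p (vars r) ++ (diffAt r p t ∷ removeIdx i (drop p (vars r)))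

phiAt : ℕ → ℕ → ℕ → Poly → Poly
phiAt r p j P =
  P +P sumP r (map (λ t → substP r P (substArgs r p t t) -P substP r P (substArgs r p t (t ∸ 1)))
                   (oneTo (j ∸ 1)))

diffVar : ℕ → ℕ → Poly
diffVar j s = var j (suc s) -P var j s

co-subst-monomial : (r : ℕ) (f : List ℕ) (A : List Poly) → substP r (monomial f) A ≋ evalMon r f A
co-subst-monomial r f A e =
  trans (co-++ (scaleP 1ℚ (evalMon r f A)) [] e)
  (trans (ℚP.+-identityʳ _) (trans (co-scale 1ℚ (evalMon r f A) e) (ℚP.*-identityˡ _)))

take-length-++ : {A : Set} (p : ℕ) (xs ys : List A) → length xs ≡ p → take p (xs ++ ys) ≡ xs
take-length-++ .0       []       ys refl = refl
take-length-++ .(suc _) (x ∷ xs) ys refl = cong (x ∷_) (take-length-++ _ xs ys refl)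

drop-length-++ : {A : Set} (p : ℕ) (xs ys : List A) → length xs ≡ p → drop p (xs ++ ys) ≡ ys
drop-length-++ .0       []       ys refl = refl
drop-length-++ .(suc _) (x ∷ xs) ys refl = drop-length-++ _ xs ys refl

removeIdx-map : {A B : Set} (f : A → B) (t : ℕ) (xs : List A) → removeIdx t (map f xs) ≡ map f (removeIdx t xs)
removeIdx-map f t       []       = refl
removeIdx-map f zero    (x ∷ xs) = refl
removeIdx-map f (suc t) (x ∷ xs) = cong (f x ∷_) (removeIdx-map f t xs)

All-removeIdx : {A : Set} {P : A → Set} (t : ℕ) {xs : List A} → All P xs → All P (removeIdx t xs)
All-removeIdx t       []         = []
All-removeIdx zero    (px ∷ pxs) = pxs
All-removeIdx (suc t) (px ∷ pxs) = px ∷ All-removeIdx t pxs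

substArgs-split : (p j s i : ℕ) →
  substArgs (p ℕ.+ j) p (suc s) i ≡ prefixVars p j ++ map (shiftN p) (diffVar j s ∷ removeIdx i (vars j))
substArgs-split p j s i =
  cong₂ _++_ take-vars
    (cong₂ _∷_ diff-shifted (trans (cong (removeIdx i) drop-vars) (removeIdx-map (shiftN p) i (vars j))))
  where
  split : vars (p ℕ.+ j) ≡ prefixVars p j ++ map (shiftN p) (vars j)
  split = vars-split p j
  take-vars : take p (vars (p ℕ.+ j)) ≡ prefixVars p j
  take-vars = trans (cong (take p) split) (take-length-++ p (prefixVars p j) _ (length-prefixVars p j))
  drop-vars : drop p (vars (p ℕ.+ j)) ≡ map (shiftN p) (vars j)
  drop-vars = trans (cong (drop p) split) (drop-length-++ p (prefixVars p j) _ (length-prefixVars p j))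
  diff-shifted : diffAt (p ℕ.+ j) p (suc s) ≡ shiftN p (diffVar j s)
  diff-shifted =
    trans (cong₂ _-P_ (shiftN-var p j (suc s))
                      (trans (cong (var (p ℕ.+ j)) (cong (_∸ 1) (ℕP.+-suc p s))) (shiftN-var p j s)))
          (sym (shiftN-sub p (var j (suc s)) (var j s)))

module SingleMonomial (p : ℕ) (pre : List ℕ) (a : ℕ) (b : List ℕ) (lp : length pre ≡ p) where

  k j r : ℕ
  k = length b
  j = suc k
  r = p ℕ.+ j

  ab : List ℕ
  ab = a ∷ b

  P : Poly
  P = monomial (pre ++ ab)

  -- coefficient of the term of x^a ∘ x^b in which x_{i+1} is omitted
  termCo : ℕ → ℕ → List ℕ → ℚ
  termCo s i = co (evalMon j ab (diffVar j s ∷ removeIdx i (vars j)))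

  WF-termArgs : (s i : ℕ) → All (WF j) (diffVar j s ∷ removeIdx i (vars j))
  WF-termArgs s i = WF-sub (WF-var j (suc s)) (WF-var j s) ∷ All-removeIdx i (WF-vars j)

  co-subst-term : (s i : ℕ) (e : List ℕ) → co (substP r P (substArgs r p (suc s) i)) e ≡ Φ pre (termCo s i) e
  co-subst-term s i e =
    trans (co-subst-monomial r (pre ++ ab) (substArgs r p (suc s) i) e)
    (trans (cong (λ z → co (evalMon r (pre ++ ab) z) e) (substArgs-split p j s i))
           (evalMon-prefix p j pre ab lp _ (WF-termArgs s i) e))

  phi-summand : (s : ℕ) (e : List ℕ) →
    co (substP r P (substArgs r p (suc s) (suc s)) -P substP r P (substArgs r p (suc s) s)) e
    ≡ Φ pre (termCo s (suc s)) e + - 1ℚ * Φ pre (termCo s s) e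
  phi-summand s e =
    trans (co-subP (substP r P (substArgs r p (suc s) (suc s))) (substP r P (substArgs r p (suc s) s)) e)
          (cong₂ (λ u v → u + - 1ℚ * v) (co-subst-term s (suc s) e) (co-subst-term s s e))

  circSummand : ℕ → Poly
  circSummand s = evalMon j ab (diffVar j s ∷ removeIdx (suc s) (vars j))
                  -P scaleP (negOnePow a) (evalMon j ab ((var j s -P var j (suc s)) ∷ removeIdx s (vars j)))

  circ-summand : (s : ℕ) (e : List ℕ) →
    Φ pre (co (circSummand s)) e ≡ Φ pre (termCo s (suc s)) e + - 1ℚ * Φ pre (termCo s s) e
  circ-summand s e =
    trans (Φ-cong pre signed e)
    (trans (Φ-+ pre (termCo s (suc s)) (λ y → - 1ℚ * termCo s s y) e)
           (cong (Φ pre (termCo s (suc s)) e +_) (Φ-* pre (- 1ℚ) (termCo s s) e)))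
    where
    R : List Poly
    R = removeIdx s (vars j)
    signed : ∀ y → co (circSummand s) y ≡ termCo s (suc s) y + - 1ℚ * termCo s s y
    signed y =
      trans (co-subP (evalMon j ab (diffVar j s ∷ removeIdx (suc s) (vars j))) (scaleP (negOnePow a) (evalMon j ab ((var j s -P var j (suc s)) ∷ R))) y)
      (cong (λ z → termCo s (suc s) y + - 1ℚ * z)
        (trans (co-scale (negOnePow a) (evalMon j ab ((var j s -P var j (suc s)) ∷ R)) y)
               (sign-rule j (var j s) (var j (suc s)) (WF-var j s) (WF-var j (suc s)) a b R
                          (All-removeIdx s (WF-vars j)) y)))

  phiAt-monomial : ∀ e → co (phiAt r p j P) e ≡ Φ pre (co (circMon a b)) e
  phiAt-monomial e = begin
    co (phiAt r p j P) e
      ≡⟨ co-++ P (sumP r (map F (oneTo k))) e ⟩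
    co P e + co (sumP r (map F (oneTo k))) e
      ≡⟨ cong₂ _+_ leading (trans (co-sumP r F (oneTo k) e) (ΣL-map suc (upTo k) (λ t → co (F t) e))) ⟩
    Φ pre M e + ΣL (upTo k) (λ s → co (F (suc s)) e)
      ≡⟨ cong (Φ pre M e +_) (ΣL-cong (upTo k) (λ s → trans (phi-summand s e) (sym (circ-summand s e)))) ⟩
    Φ pre M e + ΣL (upTo k) (λ s → Φ pre (co (circSummand s)) e)
      ≡⟨ cong (Φ pre M e +_) (sym (Φ-ΣL pre (upTo k) (λ s → co (circSummand s)) e)) ⟩
    Φ pre M e + Φ pre (λ y → ΣL (upTo k) (λ s → co (circSummand s) y)) e
      ≡⟨ sym (Φ-+ pre M _ e) ⟩
    Φ pre (λ y → M y + ΣL (upTo k) (λ s → co (circSummand s) y)) e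
      ≡⟨ Φ-cong pre (λ y → sym (trans (co-++ (evalMon j ab (vars j)) (sumP j (map circSummand (upTo k))) y) (cong (M y +_) (co-sumP j circSummand (upTo k) y)))) e ⟩
    Φ pre (co (circMon a b)) e ∎
    where
    open ≡-Reasoning
    M : List ℕ → ℚ
    M = co (evalMon j ab (vars j))
    F : ℕ → Poly
    F t = substP r P (substArgs r p t t) -P substP r P (substArgs r p t (t ∸ 1))
    leading : co P e ≡ Φ pre M e
    leading = trans (single-Φ pre ab e) (Φ-cong pre (λ y → sym (evalMon-vars j ab refl y)) e)

co-substP : (r : ℕ) (P : Poly) (A : List Poly) (e : List ℕ) →
  co (substP r P A) e ≡ ΣL P (λ u → proj₁ u * co (evalMon r (proj₂ u) A) e)
co-substP r P A e =
  trans (ΣL-concatMap _ P _) (ΣL-cong P (λ u → co-scale (proj₁ u) (evalMon r (proj₂ u) A) e))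

co-as-monomials : (P : Poly) (e : List ℕ) → co P e ≡ ΣL P (λ u → proj₁ u * co (monomial (proj₂ u)) e)
co-as-monomials P e = ΣL-cong P (λ u →
  trans (cong (δ (proj₂ u) e) (sym (ℚP.*-identityʳ (proj₁ u))))
  (trans (δ-* (proj₂ u) e (proj₁ u) 1ℚ) (cong (proj₁ u *_) (sym (δ-single (proj₂ u) e 1ℚ)))))

module PhiLinear (r p j : ℕ) (e : List ℕ) where

  ts : List ℕ
  ts = oneTo (j ∸ 1)

  phiMonoCo : List ℕ → ℚ
  phiMonoCo f = co (monomial f) e
    + ΣL ts (λ t → co (evalMon r f (substArgs r p t t)) e + - 1ℚ * co (evalMon r f (substArgs r p t (t ∸ 1))) e)

  co-phiAt : (P : Poly) → co (phiAt r p j P) e ≡ ΣL P (λ u → proj₁ u * phiMonoCo (proj₂ u))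
  co-phiAt P = begin
    co (phiAt r p j P) e
      ≡⟨ co-++ P _ e ⟩
    co P e + co (sumP r (map F ts)) e
      ≡⟨ cong₂ _+_ (co-as-monomials P e) (trans (co-sumP r F ts e) (ΣL-cong ts summand)) ⟩
    ΣL P (λ u → c u * x u) + ΣL ts (λ t → ΣL P (λ u → c u * y u t + - 1ℚ * (c u * z u t)))
      ≡⟨ cong (ΣL P (λ u → c u * x u) +_) (sym (ΣL-swap P ts _)) ⟩
    ΣL P (λ u → c u * x u) + ΣL P (λ u → ΣL ts (λ t → c u * y u t + - 1ℚ * (c u * z u t)))
      ≡⟨ sym (ΣL-+ P _ _) ⟩
    ΣL P (λ u → c u * x u + ΣL ts (λ t → c u * y u t + - 1ℚ * (c u * z u t)))
      ≡⟨ ΣL-cong P factor ⟩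
    ΣL P (λ u → c u * phiMonoCo (proj₂ u)) ∎
    where
    open ≡-Reasoning
    F : ℕ → Poly
    F t = substP r P (substArgs r p t t) -P substP r P (substArgs r p t (t ∸ 1))
    c : ℚ × List ℕ → ℚ
    c = proj₁
    x : ℚ × List ℕ → ℚ
    x u = co (monomial (proj₂ u)) e
    y z : ℚ × List ℕ → ℕ → ℚ
    y u t = co (evalMon r (proj₂ u) (substArgs r p t t)) e
    z u t = co (evalMon r (proj₂ u) (substArgs r p t (t ∸ 1))) e
    summand : ∀ t → co (F t) e ≡ ΣL P (λ u → c u * y u t + - 1ℚ * (c u * z u t))
    summand t =
      trans (co-subP (substP r P (substArgs r p t t)) (substP r P (substArgs r p t (t ∸ 1))) e)
      (trans (cong₂ (λ v w → v + - 1ℚ * w) (co-substP r P _ e) (co-substP r P _ e))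
      (sym (trans (ΣL-+ P _ _) (cong (ΣL P (λ u → c u * y u t) +_) (ΣL-* P (- 1ℚ) (λ u → c u * z u t))))))
    factor : ∀ u → c u * x u + ΣL ts (λ t → c u * y u t + - 1ℚ * (c u * z u t)) ≡ c u * phiMonoCo (proj₂ u)
    factor u =
      trans (cong (c u * x u +_)
        (trans (ΣL-cong ts (λ t → solve 3 (λ c' a b → c' :* a :+ con (- 1ℚ) :* (c' :* b)
                                                   := c' :* (a :+ con (- 1ℚ) :* b)) refl (c u) (y u t) (z u t)))
               (ΣL-* ts (c u) _)))
      (sym (ℚP.*-distribˡ-+ (c u) (x u) _))

  co-phiAt-monomial : (f : List ℕ) → co (phiAt r p j (monomial f)) e ≡ phiMonoCo f
  co-phiAt-monomial f = trans (co-phiAt (monomial f)) (trans (ℚP.+-identityʳ _) (ℚP.*-identityˡ _))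

  phiAt-linear : (P : Poly) →
    co (phiAt r p j P) e ≡ ΣL P (λ u → proj₁ u * co (phiAt r p j (monomial (proj₂ u))) e)
  phiAt-linear P =
    trans (co-phiAt P) (ΣL-cong P (λ u → cong (proj₁ u *_) (sym (co-phiAt-monomial (proj₂ u)))))

-- The index set S_{N,r}: its tuples have length r and odd entries ≥ 3,
-- so the exponents n_i - 1 of the basis monomials are even and ≥ 2

odd-suc : (k : ℕ) → (suc k ℕ.% 2 ℕ.≡ᵇ 1) ≡ (k ℕ.% 2 ℕ.≡ᵇ 0)
odd-suc zero          = refl
odd-suc (suc zero)    = refl
odd-suc (suc (suc k)) =
  trans (cong (λ z → z ℕ.≡ᵇ 1) (mod2-+2 (suc k)))
  (trans (odd-suc k) (cong (λ z → z ℕ.≡ᵇ 0) (sym (mod2-+2 k))))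
  where
  mod2-+2 : (m : ℕ) → suc (suc m) ℕ.% 2 ≡ m ℕ.% 2
  mod2-+2 m = trans (cong (ℕ._% 2) (ℕP.+-comm 2 m)) (DM.[m+n]%n≡m%n m 2)

oddGe3⇒evenGe2 : (k : ℕ) → oddGe3 k ≡ true → evenGe2 (k ∸ 1) ≡ true
oddGe3⇒evenGe2 zero    ()
oddGe3⇒evenGe2 (suc k) h = trans (cong (_∧ (2 ℕ.≤ᵇ k)) (sym (odd-suc k))) h

oddGe3⇒pos : (k : ℕ) → oddGe3 k ≡ true → 1 ≤ k
oddGe3⇒pos zero    ()
oddGe3⇒pos (suc k) h = ℕ.s≤s ℕ.z≤n

Admissible : ℕ → List ℕ → Set
Admissible r m = (length m ≡ r) × All (λ x → oddGe3 x ≡ true) m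

S-admissible : (N r : ℕ) → All (Admissible r) (S N r)
S-admissible N zero with N ℕ.≡ᵇ 0
... | true  = (refl , []) ∷ []
... | false = []
S-admissible N (suc r) =
  AllP.concat⁺ (AllP.map⁺ (extend (filter (λ k → oddGe3 k ≟b true) (L.downFrom (suc N)))
                                  (AllP.all-filter (λ k → oddGe3 k ≟b true) (L.downFrom (suc N)))))
  where
  extend : (ks : List ℕ) → All (λ k → oddGe3 k ≡ true) ks →
           All (λ k → All (Admissible (suc r)) (map (k ∷_) (S (N ∸ k) r))) ks
  extend []       []       = []
  extend (k ∷ ks) (h ∷ hs) =
    AllP.map⁺ (All.map (λ { (l , a) → cong suc l , h ∷ a }) (S-admissible (N ∸ k) r)) ∷ extend ks hs

tup-admissible : (N r : ℕ) (i : Fin (dim N r)) → Admissible r (tup N r i)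
tup-admissible N r i = All.lookup (S-admissible N r) (∈-lookup i)

allB-evenGe2 : (m : List ℕ) → All (λ x → oddGe3 x ≡ true) m → allB evenGe2 (map (_∸ 1) m) ≡ true
allB-evenGe2 []      []       = refl
allB-evenGe2 (x ∷ m) (h ∷ hs) rewrite oddGe3⇒evenGe2 x h = allB-evenGe2 m hs

co-rtePart : (P : Poly) (e : List ℕ) → allB evenGe2 e ≡ true → co (rtePart P) e ≡ co P e
co-rtePart []            e h = refl
co-rtePart ((c , f) ∷ P) e h with allB evenGe2 f ≟b true
... | yes _  = cong (δ f e c +_) (co-rtePart P e h)
... | no f-odd =
  trans (co-rtePart P e h)
        (sym (trans (cong (_+ co P e) (δ-absent (tst-no (λ f≡e → f-odd (trans (cong (allB evenGe2) f≡e) h)))))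
                    (ℚP.+-identityˡ _)))
  where
  δ-absent : tst f e ≡ false → δ f e c ≡ 0ℚ
  δ-absent t rewrite t = refl

phiPoly-monomial : (r j p : ℕ) (pre : List ℕ) (a : ℕ) (b e : List ℕ) →
  r ≡ p ℕ.+ suc (length b) → j ≡ suc (length b) → r ∸ j ≡ p → length pre ≡ p →
  co (phiPoly r j (monomial (pre ++ a ∷ b))) e
  ≡ (if tst pre (take p e) then co (circMon a b) (drop p e) else 0ℚ)
phiPoly-monomial .(p ℕ.+ suc (length b)) .(suc (length b)) p pre a b e refl refl r∸j≡p refl =
  trans (cong (λ q → co (phiAt (p ℕ.+ suc (length b)) q (suc (length b)) (monomial (pre ++ a ∷ b))) e) r∸j≡p)
  (trans (SingleMonomial.phiAt-monomial p pre a b refl e)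
         (Φ-take pre (co (circMon a b)) e))

-- n ↦ n - 1 is injective on lists of positive numbers, so comparing the
-- exponent lists n - 1 is the same as comparing the tuples n
pred-injective : (xs ys : List ℕ) → All (1 ≤_) xs → All (1 ≤_) ys → map (_∸ 1) xs ≡ map (_∸ 1) ys → xs ≡ ys
pred-injective []           []           _        _        _  = refl
pred-injective []           (_ ∷ _)      _        _        ()
pred-injective (_ ∷ _)      []           _        _        ()
pred-injective (suc x ∷ xs) (suc y ∷ ys) (_ ∷ px) (_ ∷ py) eq =
  cong₂ _∷_ (cong suc (LP.∷-injectiveˡ eq)) (pred-injective xs ys px py (LP.∷-injectiveʳ eq))

tst-pred : (xs ys : List ℕ) → All (1 ≤_) xs → All (1 ≤_) ys → tst (map (_∸ 1) xs) (map (_∸ 1) ys) ≡ tst xs ys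
tst-pred xs ys px py with ≡-dec ℕ._≟_ xs ys
... | yes refl = tst-refl (map (_∸ 1) xs)
... | no xs≢ys = tst-no (λ eq → xs≢ys (pred-injective xs ys px py eq))

length-take-≤ : {A : Set} (n : ℕ) (xs : List A) → n ≤ length xs → length (take n xs) ≡ n
length-take-≤ n xs n≤ = trans (LP.length-take n xs) (ℕP.m≤n⇒m⊓n≡m n≤)

phi-entry : (r j : ℕ) (m n : List ℕ) → 1 ≤ j → j ≤ r → Admissible r m → Admissible r n →
  co (phiPoly r j (monomial (map (_∸ 1) m))) (map (_∸ 1) n)
  ≡ (if tst (take (r ∸ j) m) (take (r ∸ j) n) then eCoef (drop (r ∸ j) m) (drop (r ∸ j) n) else 0ℚ)
phi-entry r j m n 1≤j j≤r (length-m , odd-m) (_ , odd-n) = split (drop p m) refl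
  where
  p : ℕ
  p = r ∸ j
  pos-m : All (1 ≤_) m
  pos-m = All.map (oddGe3⇒pos _) odd-m
  pos-n : All (1 ≤_) n
  pos-n = All.map (oddGe3⇒pos _) odd-n
  length-drop-m : length (drop p m) ≡ j
  length-drop-m = trans (LP.length-drop p m) (trans (cong (_∸ p) length-m) (ℕP.m∸[m∸n]≡n j≤r))
  p≤ : p ≤ length (map (_∸ 1) m)
  p≤ = ℕP.≤-trans (ℕP.m∸n≤m r j) (ℕP.≤-reflexive (sym (trans (LP.length-map (_∸ 1) m) length-m)))
  pre : List ℕ
  pre = take p (map (_∸ 1) m)
  length-pre : length pre ≡ p
  length-pre = length-take-≤ p (map (_∸ 1) m) p≤
  prefix-test : tst pre (take p (map (_∸ 1) n)) ≡ tst (take p m) (take p n)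
  prefix-test = trans (cong₂ tst (LP.take-map p m) (LP.take-map p n))
                      (tst-pred (take p m) (take p n) (AllP.take⁺ p pos-m) (AllP.take⁺ p pos-n))
  split : (d : List ℕ) → drop p m ≡ d →
    co (phiPoly r j (monomial (map (_∸ 1) m))) (map (_∸ 1) n)
    ≡ (if tst (take p m) (take p n) then eCoef d (drop p n) else 0ℚ)
  split []       eq = ⊥-elim (ℕP.<⇒≱ 1≤j (ℕP.≤-reflexive (trans (sym length-drop-m) (cong length eq))))
  split (x ∷ ms) eq = begin
    co (phiPoly r j (monomial (map (_∸ 1) m))) (map (_∸ 1) n)
      ≡⟨ cong (λ z → co (phiPoly r j (monomial z)) (map (_∸ 1) n)) m-split ⟩
    co (phiPoly r j (monomial (pre ++ (x ∸ 1) ∷ map (_∸ 1) ms))) (map (_∸ 1) n)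
      ≡⟨ phiPoly-monomial r j p pre (x ∸ 1) (map (_∸ 1) ms) (map (_∸ 1) n) r≡ j≡ refl length-pre ⟩
    (if tst pre (take p (map (_∸ 1) n)) then co (circMon (x ∸ 1) (map (_∸ 1) ms)) (drop p (map (_∸ 1) n)) else 0ℚ)
      ≡⟨ cong₂ (λ t z → if t then z else 0ℚ) prefix-test
               (trans (cong (co (circMon (x ∸ 1) (map (_∸ 1) ms))) (LP.drop-map p n))
                      (sym (coeff≡co (circMon (x ∸ 1) (map (_∸ 1) ms)) (map (_∸ 1) (drop p n))))) ⟩
    (if tst (take p m) (take p n) then eCoef (x ∷ ms) (drop p n) else 0ℚ) ∎
    where
    open ≡-Reasoning
    m-split : map (_∸ 1) m ≡ pre ++ (x ∸ 1) ∷ map (_∸ 1) ms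
    m-split = trans (sym (LP.take++drop≡id p (map (_∸ 1) m)))
                    (cong (pre ++_) (trans (LP.drop-map p m) (cong (map (_∸ 1)) eq)))
    j≡ : j ≡ suc (length (map (_∸ 1) ms))
    j≡ = trans (sym length-drop-m) (trans (cong length eq) (cong suc (sym (LP.length-map (_∸ 1) ms))))
    r≡ : r ≡ p ℕ.+ suc (length (map (_∸ 1) ms))
    r≡ = trans (sym (ℕP.m∸n+n≡m j≤r)) (cong (p ℕ.+_) j≡)

sumFin-cong : {d : ℕ} {f g : Fin d → ℚ} → (∀ i → f i ≡ g i) → sumFin f ≡ sumFin g
sumFin-cong {zero}  eq = refl
sumFin-cong {suc d} eq = cong₂ _+_ (eq F.zero) (sumFin-cong (λ i → eq (F.suc i)))

ΣL-toPoly : (xs : List (List ℕ)) (Q : Fin (length xs) → ℚ) (H : ℚ × List ℕ → ℚ) →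
  ΣL (zipWith _,_ (L.tabulate Q) xs) H ≡ sumFin (λ i → H (Q i , L.lookup xs i))
ΣL-toPoly []       Q H = refl
ΣL-toPoly (x ∷ xs) Q H = cong (H (Q F.zero , x) +_) (ΣL-toPoly xs (λ i → Q (F.suc i)) H)

phi-is-matrix : (N r j : ℕ) → 1 ≤ j → j ≤ r → (Q : Vec' (dim N r)) → phi N r j Q ≈v (Q ·v Ej N r j)
phi-is-matrix N r j 1≤j j≤r Q k = begin
  coeff (rtePart (phiPoly r j (toPoly N r Q))) nk
    ≡⟨ coeff≡co (rtePart (phiPoly r j (toPoly N r Q))) nk ⟩
  co (rtePart (phiPoly r j (toPoly N r Q))) nk
    ≡⟨ co-rtePart (phiPoly r j (toPoly N r Q)) nk (allB-evenGe2 (tup N r k) (proj₂ (tup-admissible N r k))) ⟩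
  co (phiAt r (r ∸ j) j (toPoly N r Q)) nk
    ≡⟨ PhiLinear.phiAt-linear r (r ∸ j) j nk (toPoly N r Q) ⟩
  ΣL (toPoly N r Q) H
    ≡⟨ ΣL-map _ (zipWith _,_ (L.tabulate Q) (S N r)) H ⟩
  ΣL (zipWith _,_ (L.tabulate Q) (S N r)) (λ u → H (proj₁ u , map (_∸ 1) (proj₂ u)))
    ≡⟨ ΣL-toPoly (S N r) Q (λ u → H (proj₁ u , map (_∸ 1) (proj₂ u))) ⟩
  sumFin (λ i → Q i * co (phiPoly r j (monomial (map (_∸ 1) (tup N r i)))) nk)
    ≡⟨ sumFin-cong (λ i → cong (Q i *_) (phi-entry r j (tup N r i) (tup N r k) 1≤j j≤r
                                          (tup-admissible N r i) (tup-admissible N r k))) ⟩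
  (Q ·v Ej N r j) k ∎
  where
  open ≡-Reasoning
  nk : List ℕ
  nk = map (_∸ 1) (tup N r k)
  H : ℚ × List ℕ → ℚ
  H u = proj₁ u * co (phiAt r (r ∸ j) j (monomial (proj₂ u))) nk

sumFin-0 : {d : ℕ} → sumFin {d} (λ _ → 0ℚ) ≡ 0ℚ
sumFin-0 {zero}  = refl
sumFin-0 {suc d} = trans (ℚP.+-identityˡ _) (sumFin-0 {d})

sumFin-+ : {d : ℕ} (f g : Fin d → ℚ) → sumFin (λ i → f i + g i) ≡ sumFin f + sumFin g
sumFin-+ {zero}  f g = refl
sumFin-+ {suc d} f g rewrite sumFin-+ (λ i → f (F.suc i)) (λ i → g (F.suc i)) =
  solve 4 (λ a b c d → (a :+ b) :+ (c :+ d) := (a :+ c) :+ (b :+ d)) refl (f F.zero) (g F.zero) _ _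

sumFin-* : {d : ℕ} (c : ℚ) (f : Fin d → ℚ) → sumFin (λ i → c * f i) ≡ c * sumFin f
sumFin-* {zero}  c f = sym (ℚP.*-zeroʳ c)
sumFin-* {suc d} c f rewrite sumFin-* c (λ i → f (F.suc i)) = sym (ℚP.*-distribˡ-+ c (f F.zero) _)

sumFin-swap : {d e : ℕ} (f : Fin d → Fin e → ℚ) →
  sumFin (λ i → sumFin (λ j → f i j)) ≡ sumFin (λ j → sumFin (λ i → f i j))
sumFin-swap {zero} {e} f = sym (sumFin-0 {e})
sumFin-swap {suc d} f =
  trans (cong (sumFin (λ j → f F.zero j) +_) (sumFin-swap (λ i → f (F.suc i))))
        (sym (sumFin-+ (λ j → f F.zero j) (λ j → sumFin (λ i → f (F.suc i) j))))

·v-cong : {d : ℕ} (u w : Vec' d) (A : Mat d) → u ≈v w → (u ·v A) ≈v (w ·v A)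
·v-cong u w A eq k = sumFin-cong (λ j → cong (_* A j k) (eq j))

·v-assoc : {d : ℕ} (v : Vec' d) (A B : Mat d) → ((v ·v A) ·v B) ≈v (v ·v (A ·M B))
·v-assoc v A B l =
  trans (sumFin-cong (λ k → trans (ℚP.*-comm _ (B k l))
          (trans (sym (sumFin-* (B k l) (λ j → v j * A j k)))
                 (sumFin-cong (λ j → solve 3 (λ b x y → b :* (x :* y) := x :* (y :* b)) refl
                                             (B k l) (v j) (A j k))))))
  (trans (sumFin-swap (λ k j → v j * (A j k * B k l)))
  (sumFin-cong (λ j → sumFin-* (v j) (λ k → A j k * B k l))))

·v-id : {d : ℕ} (v : Vec' d) → (v ·v idMat) ≈v v
·v-id {suc d} v F.zero =
  trans (cong₂ _+_ (ℚP.*-identityʳ (v F.zero))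
          (trans (sumFin-cong (λ j → ℚP.*-zeroʳ (v (F.suc j)))) (sumFin-0 {d})))
        (ℚP.+-identityʳ _)
·v-id {suc d} v (F.suc k) =
  trans (cong₂ _+_ (ℚP.*-zeroʳ (v F.zero))
          (trans (sumFin-cong (λ i → cong (v (F.suc i) *_) (idMat-suc i k))) (·v-id {d} (λ j → v (F.suc j)) k)))
        (ℚP.+-identityˡ _)
  where
  idMat-suc : (i k : Fin d) → idMat {suc d} (F.suc i) (F.suc k) ≡ idMat {d} i k
  idMat-suc i k with i F.≟ k
  ... | yes _ = refl
  ... | no _  = refl

phi-fold-is-matrix : (N r : ℕ) (js : List ℕ) → All (λ j → (1 ≤ j) × (j ≤ r)) js →
  (G : Vec' (dim N r) → Vec' (dim N r)) (A : Mat (dim N r)) → (∀ P → G P ≈v (P ·v A)) →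
  ∀ P → L.foldl (λ G' j → λ Q → phi N r j (G' Q)) G js P ≈v (P ·v L.foldl (λ B j → B ·M Ej N r j) A js)
phi-fold-is-matrix N r []       []               G A G≈A = G≈A
phi-fold-is-matrix N r (j ∷ js) ((1≤j , j≤r) ∷ hs) G A G≈A =
  phi-fold-is-matrix N r js hs (λ Q → phi N r j (G Q)) (A ·M Ej N r j)
    (λ P k → trans (phi-is-matrix N r j 1≤j j≤r (G P) k)
             (trans (·v-cong (G P) (P ·v A) (Ej N r j) (G≈A P) k) (·v-assoc P A (Ej N r j) k)))

twoTo-bounded : (r : ℕ) → 2 ≤ r → All (λ j → (1 ≤ j) × (j ≤ r)) (twoTo r)
twoTo-bounded r 2≤r = AllP.map⁺ (All.map (λ {t} t< → ℕ.s≤s ℕ.z≤n , bound t t<) (AllP.all-upTo (r ∸ 2)))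
  where
  bound : (t : ℕ) → t ℕ.< r ∸ 2 → suc (suc t) ≤ r
  bound t t< = ℕP.≤-trans (ℕP.n≤1+n _)
    (ℕP.≤-trans (ℕP.≤-reflexive (ℕP.+-comm 2 (suc t)))
    (ℕP.≤-trans (ℕP.+-monoˡ-≤ 2 t<) (ℕP.≤-reflexive (ℕP.m∸n+n≡m 2≤r))))

phiComp-is-matrix : (N r : ℕ) → 2 ≤ r → ∀ P → phiComp N r P ≈v (P ·v Eprod N r)
phiComp-is-matrix N r 2≤r =
  phi-fold-is-matrix N r (twoTo r) (twoTo-bounded r 2≤r) (λ Q → Q) idMat (λ P k → sym (·v-id P k))

-- E^{(r)}_{N,r} = E_{N,r}: with no untouched variables the δ-factor is 1
E≡Ej : (N r : ℕ) (i k : Fin (dim N r)) → E N r i k ≡ Ej N r r i k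
E≡Ej N r i k rewrite ℕP.n∸n≡0 r = refl

phiR-is-E : (N r : ℕ) → 1 ≤ r → (w : Vec' (dim N r)) → phi N r r w ≈v (w ·v E N r)
phiR-is-E N r 1≤r w k =
  trans (phi-is-matrix N r r 1≤r ℕP.≤-refl w k) (sumFin-cong (λ i → cong (w i *_) (sym (E≡Ej N r i k))))

same-subspace-≅ : {d : ℕ} {U W : Vec' d → Set} → (∀ w → U w → W w) → (∀ w → W w → U w) → U ≅ W
same-subspace-≅ U⊆W W⊆U = record
  { to        = λ u → u
  ; from      = λ w → w
  ; to-cong   = λ u u' eq → eq
  ; from-cong = λ w w' eq → eq
  ; to-mem    = U⊆W
  ; from-mem  = W⊆U
  ; to-add    = λ u u' _ _ i → refl
  ; to-scale  = λ c u _ i → refl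
  ; from-to   = λ u _ i → refl
  ; to-from   = λ w _ i → refl
  }

corollary4p7 : (N r : ℕ) → 1 ≤ N → 2 ≤ r → LHS N r ≅ RHS N r
corollary4p7 N r _ 2≤r = same-subspace-≅ LHS⊆RHS RHS⊆LHS
  where
  phiR : (w : Vec' (dim N r)) → phi N r r w ≈v (w ·v E N r)
  phiR = phiR-is-E N r (ℕP.≤-trans (ℕ.s≤s ℕ.z≤n) 2≤r)
  phiComp≈ : ∀ P → phiComp N r P ≈v (P ·v Eprod N r)
  phiComp≈ = phiComp-is-matrix N r 2≤r
  LHS⊆RHS : ∀ w → LHS N r w → RHS N r w
  LHS⊆RHS w ((v , w≈vE) , wE≈0) =
    (λ k → trans (phiR w k) (wE≈0 k)) , (v , λ k → trans (w≈vE k) (sym (phiComp≈ v k)))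
  RHS⊆LHS : ∀ w → RHS N r w → LHS N r w
  RHS⊆LHS w (φw≈0 , (P , w≈φP)) =
    (P , λ k → trans (w≈φP k) (phiComp≈ P k)) , (λ k → trans (sym (phiR w k)) (φw≈0 k))
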